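{- Let $n,k$ be positive integers and let $\alpha=(\alpha_1,\ldots,\alpha_k)$ be integers with $n\ge\alpha_1\ge\alpha_2\ge\cdots\ge\alpha_k\ge 0$. Define the following finite sets of cells (cell $(i,j)$ lies in row $i$ and column $j$; rows are numbered from bottom to top, columns from left to right): $$D=\{(i,j)\mid 1\le i\le k,\ 1\le j\le \alpha_{k-i+1}\},\qquad R=\{(i,j)\mid 1\le i\le k,\ 1\le j\le n\},$$ $$T=\{(i,j)\mid 1\le i\le k,\ \alpha_1-\alpha_i+1\le j\le n+\alpha_1-\alpha_i\},$$ $$V=\{(i,j)\mid k+1\le i\le 2k,\ n+\alpha_1-\alpha_{i-k}+1\le j\le n+\alpha_1\},\qquad SQ=T\cup V.$$ Then, as multisets, $$AL(SQ)=AL(R)\uplus AL(D),$$ where $\uplus$ denotes multiset union (sum of multiplicities).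
   Context: For a finite set of cells $G$ (a skew diagram) and a cell $x\in G$: the arm length $a_G(x)$ is the number of cells of $G$ in the same row as $x$ and to the right of $x$; the leg length $l_G(x)$ is the number of cells of $G$ in the same column as $x$ and below $x$ (recall rows are numbered from bottom to top, so "below" means smaller row index). $AL(G)$ denotes the multiset $\{(a_G(x),l_G(x))\mid x\in G\}$ of arm–leg pairs over all cells of $G$. -}

module Defs where

open import Data.Nat using (ℕ; zero; suc; _+_; _∸_; _<_; _≡ᵇ_; _<ᵇ_)
open import Data.Bool using (Bool; true; false; _∧_)
open import Data.List using (List; []; _∷_; _++_; map; concatMap; filter; length; upTo)
open import Data.Product using (_×_; _,_; proj₁; proj₂)
open import Data.Vec using (Vec; lookup)
open import Data.Fin using (Fin)
import Data.Fin as F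
open import Relation.Binary.PropositionalEquality using (_≡_)
open import Relation.Nullary using (yes; no)
open import Data.Nat using (_≤?_)

-- A cell (i , j): row i (numbered bottom to top), column j (left to right).
Cell : Set
Cell = ℕ × ℕ

-- A finite set of cells is represented by a duplicate-free list of its cells.
-- Integer interval [a, b] = {a, a+1, ..., b} (empty if b < a).
interval : ℕ → ℕ → List ℕ
interval a b = map (a +_) (upTo (suc b ∸ a))

countB : {A : Set} → (A → Bool) → List A → ℕ
countB p []       = 0
countB p (x ∷ xs) with p x
... | true  = suc (countB p xs)
... | false = countB p xs

arm : List Cell → Cell → ℕ
arm G (i , j) = countB (λ c → (proj₁ c ≡ᵇ i) ∧ (j <ᵇ proj₂ c)) G

leg : List Cell → Cell → ℕ
leg G (i , j) = countB (λ c → (proj₂ c ≡ᵇ j) ∧ (proj₁ c <ᵇ i)) G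

-- AL(G) as a list; multiset equality is permutation (_↭_) of these lists.
AL : List Cell → List (ℕ × ℕ)
AL G = map (λ x → arm G x , leg G x) G

-- 1-indexed access α_i to α = (α_1, ..., α_k) ∈ ℕ^k; α_i for 1 ≤ i ≤ k
-- (returns 0 outside that range, never used there)
at : {k : ℕ} → Vec ℕ k → ℕ → ℕ
at {k} α zero    = 0
at {k} α (suc m) with suc m ≤? k
... | yes p = lookup α (F.fromℕ< p)
... | no  _ = 0

Dset : (k : ℕ) → Vec ℕ k → List Cell
Dset k α = concatMap (λ i → map (i ,_) (interval 1 (at α (k ∸ i + 1)))) (interval 1 k)

Rset : (n k : ℕ) → List Cell
Rset n k = concatMap (λ i → map (i ,_) (interval 1 n)) (interval 1 k)

Tset : (n k : ℕ) → Vec ℕ k → List Cell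
Tset n k α = concatMap
  (λ i → map (i ,_) (interval (at α 1 ∸ at α i + 1) (n + at α 1 ∸ at α i)))
  (interval 1 k)

Vset : (n k : ℕ) → Vec ℕ k → List Cell
Vset n k α = concatMap
  (λ i → map (i ,_) (interval (n + at α 1 ∸ at α (i ∸ k) + 1) (n + at α 1)))
  (interval (k + 1) (k + k))

-- SQ = T ∪ V  (T lies in rows 1..k and V in rows k+1..2k, so the union is disjoint
-- and is represented by list concatenation)
SQset : (n k : ℕ) → Vec ℕ k → List Cell
SQset n k α = Tset n k α ++ Vset n k α

Admissible : (n k : ℕ) → Vec ℕ k → Set
Admissible n k α = (at α 1 Data.Nat.≤ n) ×
  ((i : ℕ) → 1 Data.Nat.≤ i → i < k → at α (suc i) Data.Nat.≤ at α i)

module Submission where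

-- Compare the multiplicity of each arm–leg pair (m , l). All four shapes are stacks of row
-- intervals; a row of length > m has exactly one cell of arm m, whose leg is the number of
-- lower rows meeting its column. No row is longer than n, so let m < n, put β_x = α_{x+1}
-- (x < k, weakly decreasing), let β′ be β reversed and s = #{x | β_x ≤ m}. The legs of the
-- arm-m cells are
--   T : t_x = #{x′ < x | β_x′ ≤ β_x + m}, for all x;   V : s + x, for the x with β_x > m;
--   R : x, for all x;   D : d_x = #{x′ < x | β′_x ≤ β′_x′ + m}, for the x with β′_x > m.
-- The rows with β′_x ≤ m are the first s rows of D and have d_x = x, while the remaining
-- legs s, …, k − 1 of R are those of V. So it remains to show {t_x} = {d_x} as multisets,
-- which goes by induction on k.

open import Defs
open import Data.Bool using (Bool; true; false; _∧_; if_then_else_; T)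
open import Data.Empty using (⊥-elim)
open import Data.List using (List; []; _∷_; _++_; map; concat; concatMap; applyUpTo; upTo)
open import Data.List.Relation.Binary.Permutation.Propositional using (_↭_; ↭-refl; ↭-sym; ↭-trans; ↭-prep)
open import Data.List.Relation.Binary.Permutation.Propositional.Properties using (shift)
open import Data.Nat
open import Data.Nat.Properties
open import Algebra.Properties.CommutativeSemigroup +-commutativeSemigroup
  using (interchange; x∙yz≈y∙xz; xy∙z≈xz∙y)
open import Data.Nat.Tactic.RingSolver using (solve-∀)
open import Data.Product using (_×_; _,_; proj₁; proj₂; ∃₂)
open import Data.Product.Properties using (≡-dec)
open import Data.Sum using (_⊎_; inj₁; inj₂)
open import Data.Vec using (Vec)
open import Function using (_∘_)
open import Relation.Binary.Definitions using (DecidableEquality)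
open import Relation.Binary.PropositionalEquality
open import Relation.Nullary using (yes; no; does)
open import Relation.Nullary.Decidable using (dec-true)

-- Iverson brackets and finite sums

⟦_⟧ : Bool → ℕ
⟦ true ⟧  = 1
⟦ false ⟧ = 0

⟦∧⟧ : ∀ b b′ → ⟦ b ∧ b′ ⟧ ≡ ⟦ b ⟧ * ⟦ b′ ⟧
⟦∧⟧ true  b′ = sym (+-identityʳ ⟦ b′ ⟧)
⟦∧⟧ false b′ = refl

⟦⟧-guard : ∀ b {X Y} → (b ≡ true → X ≡ Y) → ⟦ b ⟧ * X ≡ ⟦ b ⟧ * Y
⟦⟧-guard true  X≡Y = cong (1 *_) (X≡Y refl)
⟦⟧-guard false _   = refl

⟦⟧≤1 : ∀ b → ⟦ b ⟧ ≤ 1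
⟦⟧≤1 true  = ≤-refl
⟦⟧≤1 false = z≤n

∑ : ℕ → (ℕ → ℕ) → ℕ
∑ zero    f = 0
∑ (suc n) f = ∑ n f + f n

syntax ∑ n (λ x → e) = ∑[ x < n ] e

∑-cong : ∀ n {f g : ℕ → ℕ} → (∀ x → x < n → f x ≡ g x) → ∑ n f ≡ ∑ n g
∑-cong zero    f≡g = refl
∑-cong (suc n) f≡g = cong₂ _+_ (∑-cong n (λ x x<n → f≡g x (m≤n⇒m≤1+n x<n))) (f≡g n ≤-refl)

∑-zero : ∀ n (f : ℕ → ℕ) → (∀ x → x < n → f x ≡ 0) → ∑ n f ≡ 0
∑-zero n f f≡0 = trans (∑-cong n f≡0) (∑-const-0 n)
  where
  ∑-const-0 : ∀ n → ∑[ _ < n ] 0 ≡ 0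
  ∑-const-0 zero    = refl
  ∑-const-0 (suc n) = trans (+-identityʳ _) (∑-const-0 n)

∑-1 : ∀ n → ∑[ _ < n ] 1 ≡ n
∑-1 zero    = refl
∑-1 (suc n) = trans (cong (_+ 1) (∑-1 n)) (+-comm n 1)

∑-guard-true : ∀ n {b} (f : ℕ → ℕ) → b ≡ true → ∑[ x < n ] (⟦ b ⟧ * f x) ≡ ∑ n f
∑-guard-true n f refl = ∑-cong n (λ x _ → +-identityʳ (f x))

∑-guard-false : ∀ n (b : ℕ → Bool) (f : ℕ → ℕ) → (∀ x → x < n → b x ≡ false) → ∑[ x < n ] (⟦ b x ⟧ * f x) ≡ 0
∑-guard-false n b f b≡false = ∑-zero n _ (λ x x<n → cong (λ b → ⟦ b ⟧ * f x) (b≡false x x<n))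

∑-split : ∀ p q (f : ℕ → ℕ) → ∑ (p + q) f ≡ ∑ p f + ∑[ x < q ] f (p + x)
∑-split p zero    f = trans (cong (λ r → ∑ r f) (+-identityʳ p)) (sym (+-identityʳ _))
∑-split p (suc q) f = begin
  ∑ (p + suc q) f                                ≡⟨ cong (λ r → ∑ r f) (+-suc p q) ⟩
  ∑ (p + q) f + f (p + q)                        ≡⟨ cong (_+ f (p + q)) (∑-split p q f) ⟩
  ∑ p f + ∑[ x < q ] f (p + x) + f (p + q)       ≡⟨ +-assoc (∑ p f) _ _ ⟩
  ∑ p f + ∑[ x < suc q ] f (p + x)               ∎
  where open ≡-Reasoning

∑-split≤ : ∀ {s n} (f : ℕ → ℕ) → s ≤ n → ∑ n f ≡ ∑ s f + ∑[ x < n ∸ s ] f (s + x)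
∑-split≤ {s} {n} f s≤n = trans (cong (λ r → ∑ r f) (sym (m+[n∸m]≡n s≤n))) (∑-split s (n ∸ s) f)

∑-unconsˡ : ∀ n (f : ℕ → ℕ) → ∑ (suc n) f ≡ f 0 + ∑[ x < n ] f (suc x)
∑-unconsˡ n f = ∑-split 1 n f

∑-distrib-+ : ∀ n (f g : ℕ → ℕ) → ∑[ x < n ] (f x + g x) ≡ ∑ n f + ∑ n g
∑-distrib-+ zero    f g = refl
∑-distrib-+ (suc n) f g =
  trans (cong (_+ (f n + g n)) (∑-distrib-+ n f g)) (interchange (∑ n f) (∑ n g) (f n) (g n))

∑-distribʳ-* : ∀ n (f : ℕ → ℕ) c → ∑[ x < n ] (f x * c) ≡ ∑ n f * c
∑-distribʳ-* zero    f c = refl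
∑-distribʳ-* (suc n) f c =
  trans (cong (_+ f n * c) (∑-distribʳ-* n f c)) (sym (*-distribʳ-+ c (∑ n f) (f n)))

∑-reverse : ∀ n (f : ℕ → ℕ) → ∑[ x < n ] f (n ∸ suc x) ≡ ∑ n f
∑-reverse zero    f = refl
∑-reverse (suc n) f = begin
  ∑[ x < suc n ] f (suc n ∸ suc x)      ≡⟨ ∑-unconsˡ n (λ x → f (suc n ∸ suc x)) ⟩
  f n + ∑[ x < n ] f (n ∸ suc x)        ≡⟨ cong (f n +_) (∑-reverse n f) ⟩
  f n + ∑ n f                           ≡⟨ +-comm (f n) (∑ n f) ⟩
  ∑ (suc n) f                           ∎
  where open ≡-Reasoning

∑-single : ∀ n (f : ℕ → ℕ) x → x < n → (∀ y → y < n → y ≢ x → f y ≡ 0) → ∑ n f ≡ f x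
∑-single (suc n) f x x<1+n others with x ≟ n
... | yes refl = trans (cong (_+ f x) (∑-zero n f (λ y y<n → others y (m≤n⇒m≤1+n y<n) (<⇒≢ y<n))))
                       (+-identityˡ (f x))
... | no x≢n   = trans (cong₂ _+_ (∑-single n f x x<n (λ y y<n → others y (m≤n⇒m≤1+n y<n)))
                                  (others n ≤-refl (x≢n ∘ sym)))
                       (+-identityʳ (f x))
  where
  x<n : x < n
  x<n = ≤∧≢⇒< (≤-pred x<1+n) x≢n

<ᵇ-true : ∀ {m n} → m < n → (m <ᵇ n) ≡ true
<ᵇ-true {zero}  {suc n} _         = refl
<ᵇ-true {suc m} {suc n} (s≤s m<n) = <ᵇ-true m<n

<ᵇ-false : ∀ {m n} → n ≤ m → (m <ᵇ n) ≡ false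
<ᵇ-false {m}     {zero}  _         = refl
<ᵇ-false {suc m} {suc n} (s≤s n≤m) = <ᵇ-false n≤m

≤ᵇ-true : ∀ {m n} → m ≤ n → (m ≤ᵇ n) ≡ true
≤ᵇ-true {zero}  _   = refl
≤ᵇ-true {suc m} m<n = <ᵇ-true m<n

≤ᵇ-false : ∀ {m n} → n < m → (m ≤ᵇ n) ≡ false
≤ᵇ-false {suc m} (s≤s n≤m) = <ᵇ-false n≤m

≡ᵇ-refl : ∀ n → (n ≡ᵇ n) ≡ true
≡ᵇ-refl zero    = refl
≡ᵇ-refl (suc n) = ≡ᵇ-refl n

≡ᵇ-true : ∀ {m n} → m ≡ n → (m ≡ᵇ n) ≡ true
≡ᵇ-true {m} refl = ≡ᵇ-refl m

≡ᵇ-false : ∀ {m n} → m ≢ n → (m ≡ᵇ n) ≡ false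
≡ᵇ-false {zero}  {zero}  m≢n = ⊥-elim (m≢n refl)
≡ᵇ-false {zero}  {suc n} _   = refl
≡ᵇ-false {suc m} {zero}  _   = refl
≡ᵇ-false {suc m} {suc n} m≢n = ≡ᵇ-false (m≢n ∘ cong suc)

<ᵇ-sound : ∀ {m n} → (m <ᵇ n) ≡ true → m < n
<ᵇ-sound {m} {n} m<ᵇn = <ᵇ⇒< m n (subst T (sym m<ᵇn) _)

≤ᵇ-sound : ∀ {m n} → (m ≤ᵇ n) ≡ true → m ≤ n
≤ᵇ-sound {m} {n} m≤ᵇn = ≤ᵇ⇒≤ m n (subst T (sym m≤ᵇn) _)

<ᵇ-suc : ∀ m n → (m <ᵇ suc n) ≡ (m ≤ᵇ n)
<ᵇ-suc zero    n = refl
<ᵇ-suc (suc m) n = refl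

+-cancelˡ-<ᵇ : ∀ c m n → (c + m <ᵇ c + n) ≡ (m <ᵇ n)
+-cancelˡ-<ᵇ zero    m n = refl
+-cancelˡ-<ᵇ (suc c) m n = +-cancelˡ-<ᵇ c m n

+-cancelˡ-≡ᵇ : ∀ c m n → (c + m ≡ᵇ c + n) ≡ (m ≡ᵇ n)
+-cancelˡ-≡ᵇ zero    m n = refl
+-cancelˡ-≡ᵇ (suc c) m n = +-cancelˡ-≡ᵇ c m n

+-cancelˡ-≤ᵇ : ∀ c m n → (c + m ≤ᵇ c + n) ≡ (m ≤ᵇ n)
+-cancelˡ-≤ᵇ c m n = begin
  (c + m ≤ᵇ c + n)        ≡⟨ sym (<ᵇ-suc (c + m) (c + n)) ⟩
  (c + m <ᵇ suc (c + n))  ≡⟨ cong (c + m <ᵇ_) (sym (+-suc c n)) ⟩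
  (c + m <ᵇ c + suc n)    ≡⟨ +-cancelˡ-<ᵇ c m (suc n) ⟩
  (m <ᵇ suc n)            ≡⟨ <ᵇ-suc m n ⟩
  (m ≤ᵇ n)                ∎
  where open ≡-Reasoning

⟦<ᵇ⟧+⟦≤ᵇ⟧ : ∀ m n → ⟦ m <ᵇ n ⟧ + ⟦ n ≤ᵇ m ⟧ ≡ 1
⟦<ᵇ⟧+⟦≤ᵇ⟧ m n with m <? n
... | yes m<n rewrite <ᵇ-true m<n | ≤ᵇ-false m<n = refl
... | no  m≮n rewrite <ᵇ-false (≮⇒≥ m≮n) | ≤ᵇ-true (≮⇒≥ m≮n) = refl

∑-prefix : ∀ N s (g : ℕ → ℕ) → s ≤ N → ∑[ x < N ] (⟦ x <ᵇ s ⟧ * g x) ≡ ∑ s g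
∑-prefix N s g s≤N = begin
  ∑[ x < N ] (⟦ x <ᵇ s ⟧ * g x)                                   ≡⟨ ∑-split≤ _ s≤N ⟩
  ∑[ x < s ] (⟦ x <ᵇ s ⟧ * g x) + ∑[ x < N ∸ s ] (⟦ s + x <ᵇ s ⟧ * g (s + x))
    ≡⟨ cong₂ _+_ (∑-cong s (λ x x<s → cong (λ b → ⟦ b ⟧ * g x) (<ᵇ-true x<s)))
                 (∑-zero (N ∸ s) _ (λ x _ → cong (λ b → ⟦ b ⟧ * g (s + x)) (<ᵇ-false (m≤m+n s x)))) ⟩
  ∑[ x < s ] (1 * g x) + 0                                        ≡⟨ +-identityʳ _ ⟩
  ∑[ x < s ] (g x + 0)                                            ≡⟨ ∑-cong s (λ x _ → +-identityʳ (g x)) ⟩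
  ∑ s g                                                           ∎
  where open ≡-Reasoning

∑⟦⟧≤ : ∀ k (P : ℕ → Bool) → ∑[ x < k ] ⟦ P x ⟧ ≤ k
∑⟦⟧≤ zero    P = z≤n
∑⟦⟧≤ (suc k) P = ≤-trans (+-mono-≤ (∑⟦⟧≤ k P) (⟦⟧≤1 (P k))) (≤-reflexive (+-comm k 1))

DownClosed : ℕ → (ℕ → Bool) → Set
DownClosed k P = ∀ x y → x ≤ y → y < k → P y ≡ true → P x ≡ true

downClosed⇒prefix : ∀ k (P : ℕ → Bool) → DownClosed k P →
  ∀ x → x < k → P x ≡ (x <ᵇ ∑[ y < k ] ⟦ P y ⟧)
downClosed⇒prefix (suc k) P closed x x<1+k = by-last (P k) refl
  where
  open ≡-Reasoning
  by-last : ∀ b → P k ≡ b → P x ≡ (x <ᵇ ∑[ y < suc k ] ⟦ P y ⟧)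
  by-last true Pk = begin
    P x                             ≡⟨ closed x k (≤-pred x<1+k) ≤-refl Pk ⟩
    true                            ≡⟨ sym (<ᵇ-true x<1+k) ⟩
    (x <ᵇ suc k)                    ≡⟨ cong (x <ᵇ_) (sym (∑-1 (suc k))) ⟩
    (x <ᵇ ∑[ y < suc k ] 1)         ≡⟨ cong (x <ᵇ_) (∑-cong (suc k) (λ y y<1+k →
                                         cong ⟦_⟧ (sym (closed y k (≤-pred y<1+k) ≤-refl Pk)))) ⟩
    (x <ᵇ ∑[ y < suc k ] ⟦ P y ⟧)   ∎
  by-last false Pk = trans (below (m<1+n⇒m<n∨m≡n x<1+k)) (cong (x <ᵇ_) (sym last-false))
    where
    last-false : ∑[ y < suc k ] ⟦ P y ⟧ ≡ ∑[ y < k ] ⟦ P y ⟧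
    last-false = trans (cong (λ b → ∑[ y < k ] ⟦ P y ⟧ + ⟦ b ⟧) Pk) (+-identityʳ _)
    below : x < k ⊎ x ≡ k → P x ≡ (x <ᵇ ∑[ y < k ] ⟦ P y ⟧)
    below (inj₁ x<k)  = downClosed⇒prefix k P (λ x y x≤y y<k → closed x y x≤y (m≤n⇒m≤1+n y<k)) x x<k
    below (inj₂ refl) = trans Pk (sym (<ᵇ-false (∑⟦⟧≤ x P)))

∑-downClosed : ∀ k (P : ℕ → Bool) (g : ℕ → ℕ) → DownClosed k P →
  ∑[ x < k ] (⟦ P x ⟧ * g x) ≡ ∑[ x < ∑[ y < k ] ⟦ P y ⟧ ] g x
∑-downClosed k P g closed =
  trans (∑-cong k (λ x x<k → cong (λ b → ⟦ b ⟧ * g x) (downClosed⇒prefix k P closed x x<k)))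
        (∑-prefix k _ g (∑⟦⟧≤ k P))

-- Comparing lists as multisets by occurrence counts

∑ˡ : {A : Set} → (A → ℕ) → List A → ℕ
∑ˡ h []       = 0
∑ˡ h (x ∷ xs) = h x + ∑ˡ h xs

∑ˡ-++ : {A : Set} (h : A → ℕ) (xs ys : List A) → ∑ˡ h (xs ++ ys) ≡ ∑ˡ h xs + ∑ˡ h ys
∑ˡ-++ h []       ys = refl
∑ˡ-++ h (x ∷ xs) ys = trans (cong (h x +_) (∑ˡ-++ h xs ys)) (sym (+-assoc (h x) _ _))

∑ˡ-map : {A B : Set} (h : B → ℕ) (f : A → B) (xs : List A) → ∑ˡ h (map f xs) ≡ ∑ˡ (h ∘ f) xs
∑ˡ-map h f []       = refl
∑ˡ-map h f (x ∷ xs) = cong (h (f x) +_) (∑ˡ-map h f xs)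

∑ˡ-concatMap : {A B : Set} (h : B → ℕ) (f : A → List B) (xs : List A) →
  ∑ˡ h (concatMap f xs) ≡ ∑ˡ (∑ˡ h ∘ f) xs
∑ˡ-concatMap h f []       = refl
∑ˡ-concatMap h f (x ∷ xs) =
  trans (∑ˡ-++ h (f x) (concat (map f xs))) (cong (∑ˡ h (f x) +_) (∑ˡ-concatMap h f xs))

∑ˡ-applyUpTo : {A : Set} (h : A → ℕ) (f : ℕ → A) (n : ℕ) → ∑ˡ h (applyUpTo f n) ≡ ∑[ x < n ] h (f x)
∑ˡ-applyUpTo h f zero    = refl
∑ˡ-applyUpTo h f (suc n) =
  trans (cong (h (f 0) +_) (∑ˡ-applyUpTo h (f ∘ suc) n)) (sym (∑-unconsˡ n (h ∘ f)))

countB-∑ˡ : {A : Set} (p : A → Bool) (xs : List A) → countB p xs ≡ ∑ˡ (λ z → ⟦ p z ⟧) xs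
countB-∑ˡ p []       = refl
countB-∑ˡ p (x ∷ xs) with p x
... | true  = cong suc (countB-∑ˡ p xs)
... | false = countB-∑ˡ p xs

module Occurrences {A : Set} (_≟ᴬ_ : DecidableEquality A) where

  occ : A → List A → ℕ
  occ v = ∑ˡ (λ u → ⟦ does (u ≟ᴬ v) ⟧)

  occ-self : ∀ x xs → occ x (x ∷ xs) ≡ suc (occ x xs)
  occ-self x xs = cong (λ b → ⟦ b ⟧ + occ x xs) (dec-true (x ≟ᴬ x) refl)

  occ-middle : ∀ v x ys₁ ys₂ → occ v (ys₁ ++ x ∷ ys₂) ≡ ⟦ does (x ≟ᴬ v) ⟧ + occ v (ys₁ ++ ys₂)
  occ-middle v x ys₁ ys₂ = begin
    occ v (ys₁ ++ x ∷ ys₂)                ≡⟨ ∑ˡ-++ _ ys₁ (x ∷ ys₂) ⟩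
    occ v ys₁ + (⟦ b ⟧ + occ v ys₂)       ≡⟨ x∙yz≈y∙xz (occ v ys₁) ⟦ b ⟧ (occ v ys₂) ⟩
    ⟦ b ⟧ + (occ v ys₁ + occ v ys₂)       ≡⟨ cong (⟦ b ⟧ +_) (sym (∑ˡ-++ _ ys₁ ys₂)) ⟩
    ⟦ b ⟧ + occ v (ys₁ ++ ys₂)            ∎
    where
    open ≡-Reasoning
    b = does (x ≟ᴬ v)

  occ-split : ∀ x ys → 0 < occ x ys → ∃₂ λ ys₁ ys₂ → ys ≡ ys₁ ++ x ∷ ys₂
  occ-split x (y ∷ ys) occ>0 with y ≟ᴬ x
  ... | yes refl = [] , ys , refl
  ... | no _ with occ-split x ys occ>0
  ...   | ys₁ , ys₂ , refl = y ∷ ys₁ , ys₂ , refl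

  occ⇒↭ : ∀ xs ys → (∀ v → occ v xs ≡ occ v ys) → xs ↭ ys
  occ⇒↭ []       []       _    = ↭-refl
  occ⇒↭ []       (y ∷ ys) same = ⊥-elim (0≢1+n (trans (same y) (occ-self y ys)))
  occ⇒↭ (x ∷ xs) ys       same with occ-split x ys (subst (0 <_) (trans (sym (occ-self x xs)) (same x)) z<s)
  ... | ys₁ , ys₂ , refl =
    ↭-trans (↭-prep x (occ⇒↭ xs (ys₁ ++ ys₂) same-rest)) (↭-sym (shift x ys₁ ys₂))
    where
    same-rest : ∀ v → occ v xs ≡ occ v (ys₁ ++ ys₂)
    same-rest v = +-cancelˡ-≡ ⟦ does (x ≟ᴬ v) ⟧ _ _ (trans (same v) (occ-middle v x ys₁ ys₂))

_≟²_ : DecidableEquality (ℕ × ℕ)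
_≟²_ = ≡-dec _≟_ _≟_

open Occurrences _≟²_ using (occ; occ⇒↭)

does-≟² : ∀ a b c d → does ((a , b) ≟² (c , d)) ≡ (a ≡ᵇ c) ∧ (b ≡ᵇ d)
does-≟² a b c d with a ≟ c
... | yes refl = sym (cong (_∧ (b ≡ᵇ d)) (≡ᵇ-refl a))
... | no a≢c   = sym (cong (_∧ (b ≡ᵇ d)) (≡ᵇ-false a≢c))

-- Diagrams made of row intervals

∑-⟦<ᵇ⟧ : ∀ M y → ∑[ y′ < M ] ⟦ y <ᵇ y′ ⟧ ≡ M ∸ suc y
∑-⟦<ᵇ⟧ zero    y = refl
∑-⟦<ᵇ⟧ (suc M) y with y <? M
... | yes y<M rewrite ∑-⟦<ᵇ⟧ M y | <ᵇ-true y<M = trans (+-comm (M ∸ suc y) 1) (sym (+-∸-assoc 1 y<M))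
... | no  y≮M rewrite ∑-⟦<ᵇ⟧ M y | <ᵇ-false (≮⇒≥ y≮M) | m≤n⇒m∸n≡0 (≮⇒≥ y≮M) =
  trans (+-identityʳ _) (m≤n⇒m∸n≡0 (≤-trans (≮⇒≥ y≮M) (n≤1+n y)))

inRange : ℕ → ℕ → ℕ → Bool
inRange c M j = (c ≤ᵇ j) ∧ (j <ᵇ c + M)

∑-⟦+≡ᵇ⟧ : ∀ M c j → ∑[ y < M ] ⟦ c + y ≡ᵇ j ⟧ ≡ ⟦ inRange c M j ⟧
∑-⟦+≡ᵇ⟧ M c j with c ≤? j | j <? c + M
... | yes c≤j | yes j<c+M rewrite ≤ᵇ-true c≤j | <ᵇ-true j<c+M =
  trans (∑-single M _ (j ∸ c) j∸c<M (λ y _ y≢j∸c → cong ⟦_⟧ (≡ᵇ-false (λ c+y≡j → y≢j∸c (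
          trans (sym (m+n∸m≡n c y)) (cong (_∸ c) c+y≡j))))))
        (cong ⟦_⟧ (≡ᵇ-true (m+[n∸m]≡n c≤j)))
  where
  j∸c<M : j ∸ c < M
  j∸c<M = +-cancelˡ-< c _ _ (subst (_< c + M) (sym (m+[n∸m]≡n c≤j)) j<c+M)
... | yes c≤j | no j≮c+M rewrite ≤ᵇ-true c≤j | <ᵇ-false (≮⇒≥ j≮c+M) =
  ∑-zero M _ (λ y y<M → cong ⟦_⟧ (≡ᵇ-false (λ c+y≡j → j≮c+M (subst (_< c + M) c+y≡j (+-monoʳ-< c y<M)))))
... | no c≰j | _ rewrite ≤ᵇ-false (≰⇒> c≰j) =
  ∑-zero M _ (λ y _ → cong ⟦_⟧ (≡ᵇ-false (λ c+y≡j → c≰j (subst (c ≤_) c+y≡j (m≤m+n c y)))))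

∑-⟦∸≡ᵇ⟧∧ : ∀ M m (Q : ℕ → Bool) → ∑[ y < M ] ⟦ (M ∸ suc y ≡ᵇ m) ∧ Q y ⟧ ≡ ⟦ m <ᵇ M ⟧ * ⟦ Q (M ∸ suc m) ⟧
∑-⟦∸≡ᵇ⟧∧ zero    m Q = refl
∑-⟦∸≡ᵇ⟧∧ (suc M) m Q with m <? suc M
... | yes (s≤s m≤M) rewrite <ᵇ-true (s≤s m≤M) =
  trans (∑-single (suc M) _ (M ∸ m) (s≤s (m∸n≤m M m)) (λ y y<1+M y≢M∸m → cong (λ b → ⟦ b ∧ Q y ⟧)
          (≡ᵇ-false {M ∸ y} {m} (λ M∸y≡m → y≢M∸m (trans (sym (m∸[m∸n]≡n (≤-pred y<1+M))) (cong (M ∸_) M∸y≡m))))))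
        (trans (cong (λ b → ⟦ b ∧ Q (M ∸ m) ⟧) (≡ᵇ-true (m∸[m∸n]≡n m≤M))) (sym (+-identityʳ _)))
... | no m≮1+M rewrite <ᵇ-false (≮⇒≥ m≮1+M) =
  ∑-zero (suc M) _ (λ y _ → cong (λ b → ⟦ b ∧ Q y ⟧)
    (≡ᵇ-false (λ M∸y≡m → m≮1+M (subst (_< suc M) M∸y≡m (s≤s (m∸n≤m M y))))))

-- Equivalently, G is a permutation of the cells (a + x , c x + y) with x < N and y < M x.
record Rows (a N : ℕ) (c M : ℕ → ℕ) (G : List Cell) : Set where
  constructor rows
  field ∑ˡ-rows : ∀ (h : Cell → ℕ) → ∑ˡ h G ≡ ∑[ x < N ] ∑[ y < M x ] h (a + x , c x + y)
open Rows

rowsBelow : (c M : ℕ → ℕ) → ℕ → ℕ → ℕ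
rowsBelow c M x j = ∑[ x′ < x ] ⟦ inRange (c x′) (M x′) j ⟧

module _ {a N : ℕ} {c M : ℕ → ℕ} {G : List Cell} (R : Rows a N c M G) where
  open ≡-Reasoning

  arm-Rows : ∀ x y → x < N → y < M x → arm G (a + x , c x + y) ≡ M x ∸ suc y
  arm-Rows x y x<N y<Mx = begin
    arm G (a + x , c x + y)
      ≡⟨ trans (countB-∑ˡ _ G) (∑ˡ-rows R _) ⟩
    ∑[ x′ < N ] ∑[ y′ < M x′ ] ⟦ (a + x′ ≡ᵇ a + x) ∧ (c x + y <ᵇ c x′ + y′) ⟧
      ≡⟨ ∑-single N _ x x<N (λ x′ _ x′≢x → ∑-zero (M x′) _ (λ y′ _ →
           cong (λ b → ⟦ b ∧ (c x + y <ᵇ c x′ + y′) ⟧) (trans (+-cancelˡ-≡ᵇ a x′ x) (≡ᵇ-false x′≢x)))) ⟩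
    ∑[ y′ < M x ] ⟦ (a + x ≡ᵇ a + x) ∧ (c x + y <ᵇ c x + y′) ⟧
      ≡⟨ ∑-cong (M x) (λ y′ _ → cong₂ (λ b b′ → ⟦ b ∧ b′ ⟧) (≡ᵇ-refl (a + x)) (+-cancelˡ-<ᵇ (c x) y y′)) ⟩
    ∑[ y′ < M x ] ⟦ y <ᵇ y′ ⟧
      ≡⟨ ∑-⟦<ᵇ⟧ (M x) y ⟩
    M x ∸ suc y ∎

  leg-Rows : ∀ x j → x ≤ N → leg G (a + x , j) ≡ rowsBelow c M x j
  leg-Rows x j x≤N = begin
    leg G (a + x , j)
      ≡⟨ trans (countB-∑ˡ _ G) (∑ˡ-rows R _) ⟩
    ∑[ x′ < N ] ∑[ y′ < M x′ ] ⟦ (c x′ + y′ ≡ᵇ j) ∧ (a + x′ <ᵇ a + x) ⟧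
      ≡⟨ ∑-cong N (λ x′ _ → ∑-cong (M x′) (λ y′ _ →
           trans (cong (λ b → ⟦ (c x′ + y′ ≡ᵇ j) ∧ b ⟧) (+-cancelˡ-<ᵇ a x′ x)) (⟦∧⟧ _ (x′ <ᵇ x)))) ⟩
    ∑[ x′ < N ] ∑[ y′ < M x′ ] (⟦ c x′ + y′ ≡ᵇ j ⟧ * ⟦ x′ <ᵇ x ⟧)
      ≡⟨ ∑-cong N (λ x′ _ → trans (∑-distribʳ-* (M x′) _ ⟦ x′ <ᵇ x ⟧)
                                  (cong (_* ⟦ x′ <ᵇ x ⟧) (∑-⟦+≡ᵇ⟧ (M x′) (c x′) j))) ⟩
    ∑[ x′ < N ] (⟦ inRange (c x′) (M x′) j ⟧ * ⟦ x′ <ᵇ x ⟧)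
      ≡⟨ ∑-cong N (λ x′ _ → *-comm ⟦ inRange (c x′) (M x′) j ⟧ ⟦ x′ <ᵇ x ⟧) ⟩
    ∑[ x′ < N ] (⟦ x′ <ᵇ x ⟧ * ⟦ inRange (c x′) (M x′) j ⟧)
      ≡⟨ ∑-prefix N x _ x≤N ⟩
    rowsBelow c M x j ∎

  occ-AL-Rows : ∀ m l →
    occ (m , l) (AL G) ≡ ∑[ x < N ] (⟦ m <ᵇ M x ⟧ * ⟦ rowsBelow c M x (c x + (M x ∸ suc m)) ≡ᵇ l ⟧)
  occ-AL-Rows m l = begin
    occ (m , l) (AL G)
      ≡⟨ trans (∑ˡ-map _ _ G) (∑ˡ-rows R _) ⟩
    ∑[ x < N ] ∑[ y < M x ] ⟦ does ((arm G (a + x , c x + y) , leg G (a + x , c x + y)) ≟² (m , l)) ⟧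
      ≡⟨ ∑-cong N (λ x x<N → ∑-cong (M x) (λ y y<Mx → trans (cong ⟦_⟧ (does-≟² (arm G (a + x , c x + y)) (leg G (a + x , c x + y)) m l))
           (cong₂ (λ a′ l′ → ⟦ (a′ ≡ᵇ m) ∧ (l′ ≡ᵇ l) ⟧) (arm-Rows x y x<N y<Mx) (leg-Rows x (c x + y) (<⇒≤ x<N))))) ⟩
    ∑[ x < N ] ∑[ y < M x ] ⟦ (M x ∸ suc y ≡ᵇ m) ∧ (rowsBelow c M x (c x + y) ≡ᵇ l) ⟧
      ≡⟨ ∑-cong N (λ x _ → ∑-⟦∸≡ᵇ⟧∧ (M x) m (λ y → rowsBelow c M x (c x + y) ≡ᵇ l)) ⟩
    ∑[ x < N ] (⟦ m <ᵇ M x ⟧ * ⟦ rowsBelow c M x (c x + (M x ∸ suc m)) ≡ᵇ l ⟧) ∎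

Rows-concatMap-interval : ∀ a b (L U : ℕ → ℕ) →
  Rows a (suc b ∸ a) (λ x → L (a + x)) (λ x → suc (U (a + x)) ∸ L (a + x))
       (concatMap (λ i → map (i ,_) (interval (L i) (U i))) (interval a b))
Rows-concatMap-interval a b L U = rows λ h → begin
  ∑ˡ h (concatMap row (interval a b))
    ≡⟨ trans (∑ˡ-concatMap h row (interval a b)) (∑ˡ-map _ (a +_) (upTo (suc b ∸ a))) ⟩
  ∑ˡ (λ x → ∑ˡ h (row (a + x))) (upTo (suc b ∸ a))
    ≡⟨ ∑ˡ-applyUpTo _ (λ x → x) (suc b ∸ a) ⟩
  ∑[ x < suc b ∸ a ] ∑ˡ h (row (a + x))
    ≡⟨ ∑-cong (suc b ∸ a) (λ x _ →
         trans (∑ˡ-map h _ (interval (L (a + x)) (U (a + x))))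
         (trans (∑ˡ-map _ (L (a + x) +_) (upTo (suc (U (a + x)) ∸ L (a + x))))
                (∑ˡ-applyUpTo _ (λ y → y) (suc (U (a + x)) ∸ L (a + x))))) ⟩
  ∑[ x < suc b ∸ a ] ∑[ y < suc (U (a + x)) ∸ L (a + x) ] h (a + x , L (a + x) + y) ∎
  where
  open ≡-Reasoning
  row : ℕ → List Cell
  row i = map (i ,_) (interval (L i) (U i))

Rows-cong : ∀ {a a′ N N′ c c′ M M′ G} → Rows a N c M G → a ≡ a′ → N ≡ N′ →
  (∀ x → x < N → c x ≡ c′ x) → (∀ x → x < N → M x ≡ M′ x) → Rows a′ N′ c′ M′ G
Rows-cong {a} {N = N} R refl refl c≗c′ M≗M′ = rows λ h → trans (∑ˡ-rows R h)
  (∑-cong N (λ x x<N → cong₂ (λ M c → ∑[ y < M ] h (a + x , c + y)) (M≗M′ x x<N) (c≗c′ x x<N)))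

stack : ℕ → (ℕ → ℕ) → (ℕ → ℕ) → ℕ → ℕ
stack N f g x = if x <ᵇ N then f x else g (x ∸ N)

stack-low : ∀ {N x} (f g : ℕ → ℕ) → x < N → stack N f g x ≡ f x
stack-low f g x<N rewrite <ᵇ-true x<N = refl

stack-high : ∀ N (f g : ℕ → ℕ) x → stack N f g (N + x) ≡ g x
stack-high N f g x rewrite <ᵇ-false (m≤m+n N x) = cong g (m+n∸m≡n N x)

Rows-++ : ∀ {a N N′ c c′ M M′ G G′} → Rows a N c M G → Rows (a + N) N′ c′ M′ G′ →
  Rows a (N + N′) (stack N c c′) (stack N M M′) (G ++ G′)
Rows-++ {a} {N} {N′} {c} {c′} {M} {M′} {G} {G′} R R′ = rows ∑ˡ-++-rows
  where
  open ≡-Reasoning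
  ∑ˡ-++-rows : ∀ (h : Cell → ℕ) → ∑ˡ h (G ++ G′) ≡ ∑[ x < N + N′ ] ∑[ y < stack N M M′ x ] h (a + x , stack N c c′ x + y)
  ∑ˡ-++-rows h = begin
    ∑ˡ h (G ++ G′)
      ≡⟨ trans (∑ˡ-++ h G G′) (cong₂ _+_ (∑ˡ-rows R h) (∑ˡ-rows R′ h)) ⟩
    ∑[ x < N ] ∑[ y < M x ] h (a + x , c x + y) + ∑[ x < N′ ] ∑[ y < M′ x ] h (a + N + x , c′ x + y)
      ≡⟨ cong₂ _+_ (∑-cong N (λ x x<N → row≡ (sym (stack-low M M′ x<N)) refl (sym (stack-low c c′ x<N))))
                   (∑-cong N′ (λ x _ → row≡ (sym (stack-high N M M′ x)) (+-assoc a N x) (sym (stack-high N c c′ x)))) ⟩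
    ∑[ x < N ] S x + ∑[ x < N′ ] S (N + x)
      ≡⟨ sym (∑-split N N′ S) ⟩
    ∑[ x < N + N′ ] S x ∎
    where
    S : ℕ → ℕ
    S x = ∑[ y < stack N M M′ x ] h (a + x , stack N c c′ x + y)
    row≡ : ∀ {L L′ i i′ j j′} → L ≡ L′ → i ≡ i′ → j ≡ j′ → ∑[ y < L ] h (i , j + y) ≡ ∑[ y < L′ ] h (i′ , j′ + y)
    row≡ refl refl refl = refl

rowsBelow-stack-low : ∀ {N x} (c c′ M M′ : ℕ → ℕ) j → x ≤ N →
  rowsBelow (stack N c c′) (stack N M M′) x j ≡ rowsBelow c M x j
rowsBelow-stack-low {x = x} c c′ M M′ j x≤N = ∑-cong x (λ x′ x′<x → cong₂ (λ c M → ⟦ inRange c M j ⟧)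
  (stack-low c c′ (<-≤-trans x′<x x≤N)) (stack-low M M′ (<-≤-trans x′<x x≤N)))

rowsBelow-stack-high : ∀ N (c c′ M M′ : ℕ → ℕ) x j →
  rowsBelow (stack N c c′) (stack N M M′) (N + x) j ≡ rowsBelow c M N j + rowsBelow c′ M′ x j
rowsBelow-stack-high N c c′ M M′ x j = trans (∑-split N x _) (cong₂ _+_ (rowsBelow-stack-low {N} c c′ M M′ j ≤-refl)
  (∑-cong x (λ x′ _ → cong₂ (λ c M → ⟦ inRange c M j ⟧) (stack-high N c c′ x′) (stack-high N M M′ x′))))

occ-AL-Rows-++ : ∀ {a N N′ c c′ M M′ G G′} → Rows a N c M G → Rows (a + N) N′ c′ M′ G′ → ∀ m l →
  occ (m , l) (AL (G ++ G′)) ≡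
    ∑[ x < N ] (⟦ m <ᵇ M x ⟧ * ⟦ rowsBelow c M x (c x + (M x ∸ suc m)) ≡ᵇ l ⟧) +
    ∑[ x < N′ ] (⟦ m <ᵇ M′ x ⟧ *
      ⟦ rowsBelow c M N (c′ x + (M′ x ∸ suc m)) + rowsBelow c′ M′ x (c′ x + (M′ x ∸ suc m)) ≡ᵇ l ⟧)
occ-AL-Rows-++ {N = N} {N′} {c} {c′} {M} {M′} R R′ m l =
  trans (occ-AL-Rows (Rows-++ R R′) m l) (trans (∑-split N N′ _) (cong₂ _+_
    (∑-cong N (λ x x<N → trans (cong₂ (term x) (stack-low c c′ x<N) (stack-low M M′ x<N))
                               (cong (λ r → ⟦ m <ᵇ M x ⟧ * ⟦ r ≡ᵇ l ⟧) (rowsBelow-stack-low c c′ M M′ _ (<⇒≤ x<N)))))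
    (∑-cong N′ (λ x _ → trans (cong₂ (term (N + x)) (stack-high N c c′ x) (stack-high N M M′ x))
                              (cong (λ r → ⟦ m <ᵇ M′ x ⟧ * ⟦ r ≡ᵇ l ⟧) (rowsBelow-stack-high N c c′ M M′ x _))))))
  where
  term : ℕ → ℕ → ℕ → ℕ
  term x cx Mx = ⟦ m <ᵇ Mx ⟧ * ⟦ rowsBelow (stack N c c′) (stack N M M′) x (cx + (Mx ∸ suc m)) ≡ᵇ l ⟧

-- Windows in a monotone sequence

Antitone : ℕ → (ℕ → ℕ) → Set
Antitone k B = ∀ x y → x ≤ y → y < k → B y ≤ B x

antitone-steps : ∀ {k} {B : ℕ → ℕ} → (∀ y → suc y < k → B (suc y) ≤ B y) → Antitone k B
antitone-steps step x zero    z≤n     _     = ≤-refl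
antitone-steps step x (suc y) x≤1+y 1+y<k with m≤n⇒m<n∨m≡n x≤1+y
... | inj₂ refl  = ≤-refl
... | inj₁ x<1+y = ≤-trans (step y 1+y<k) (antitone-steps step x y (≤-pred x<1+y) (<-trans (n<1+n y) 1+y<k))

antitone-reverse : ∀ {k} {B : ℕ → ℕ} → Antitone k B → ∀ x y → x ≤ y → y < k → B (k ∸ suc x) ≤ B (k ∸ suc y)
antitone-reverse {k} anti x y x≤y y<k = anti _ _ (∸-monoʳ-≤ k (s≤s x≤y)) (∸-monoʳ-< z<s (≤-trans (s≤s x≤y) y<k))

-- above x and belowRev k x are t_x and d_x for the sequence B of length k.
module Windows (B : ℕ → ℕ) (m : ℕ) where
  open ≡-Reasoning

  above : ℕ → ℕ
  above x = ∑[ x′ < x ] ⟦ B x′ ≤ᵇ B x + m ⟧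

  belowRev : ℕ → ℕ → ℕ
  belowRev k x = ∑[ x′ < x ] ⟦ B (k ∸ suc x) ≤ᵇ B (k ∸ suc x′) + m ⟧

  belowRev-suc : ∀ k x → belowRev (suc k) (suc x) ≡ ⟦ B (k ∸ suc x) ≤ᵇ B k + m ⟧ + belowRev k x
  belowRev-suc k x = ∑-unconsˡ x _

  belowRev-full : ∀ k x → (∀ x′ → x′ < x → B (k ∸ suc x) ≤ B (k ∸ suc x′) + m) → belowRev k x ≡ x
  belowRev-full k x within = trans (∑-cong x (λ x′ x′<x → cong ⟦_⟧ (≤ᵇ-true (within x′ x′<x)))) (∑-1 x)

  -- Induction on k: the new smallest entry B k has above-count s, while in the reversed
  -- sequence it comes first and raises by one exactly the counts of the s entries within
  -- distance m of it, which were 0, 1, …, s - 1.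
  above-↭-belowRev : ∀ k → Antitone k B → ∀ l →
    ∑[ x < k ] ⟦ above x ≡ᵇ l ⟧ ≡ ∑[ x < k ] ⟦ belowRev k x ≡ᵇ l ⟧
  above-↭-belowRev zero    _    l = refl
  above-↭-belowRev (suc k) anti l = begin
    ∑[ x < k ] ⟦ above x ≡ᵇ l ⟧ + ⟦ above k ≡ᵇ l ⟧
      ≡⟨ cong₂ (λ u v → u + ⟦ v ≡ᵇ l ⟧) (above-↭-belowRev k anti′ l) above-k ⟩
    ∑[ x < k ] E x + ⟦ s ≡ᵇ l ⟧
      ≡⟨ cong (_+ ⟦ s ≡ᵇ l ⟧) (trans (∑-split≤ E s≤k) (cong (_+ tail) (∑-cong s (λ x x<s →
           cong (λ v → ⟦ v ≡ᵇ l ⟧) (belowRev-id x x<s))))) ⟩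
    ∑[ x < s ] ⟦ x ≡ᵇ l ⟧ + tail + ⟦ s ≡ᵇ l ⟧
      ≡⟨ xy∙z≈xz∙y (∑[ x < s ] ⟦ x ≡ᵇ l ⟧) tail ⟦ s ≡ᵇ l ⟧ ⟩
    ∑[ x < suc s ] ⟦ x ≡ᵇ l ⟧ + tail
      ≡⟨ trans (cong (_+ tail) (∑-unconsˡ s _)) (+-assoc ⟦ 0 ≡ᵇ l ⟧ _ tail) ⟩
    ⟦ 0 ≡ᵇ l ⟧ + (∑[ x < s ] ⟦ suc x ≡ᵇ l ⟧ + tail)
      ≡⟨ cong (⟦ 0 ≡ᵇ l ⟧ +_) (sym shifted) ⟩
    ⟦ 0 ≡ᵇ l ⟧ + ∑[ x < k ] ⟦ belowRev (suc k) (suc x) ≡ᵇ l ⟧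
      ≡⟨ sym (∑-unconsˡ k (λ x → ⟦ belowRev (suc k) x ≡ᵇ l ⟧)) ⟩
    ∑[ x < suc k ] ⟦ belowRev (suc k) x ≡ᵇ l ⟧ ∎
    where
    anti′ : Antitone k B
    anti′ x y x≤y y<k = anti x y x≤y (m≤n⇒m≤1+n y<k)
    P : ℕ → Bool
    P x = B (k ∸ suc x) ≤ᵇ B k + m
    closed : DownClosed k P
    closed x y x≤y y<k Py = ≤ᵇ-true (≤-trans (antitone-reverse anti′ x y x≤y y<k) (≤ᵇ-sound Py))
    s : ℕ
    s = ∑[ x < k ] ⟦ P x ⟧
    s≤k : s ≤ k
    s≤k = ∑⟦⟧≤ k P
    prefix : ∀ x → x < k → P x ≡ (x <ᵇ s)
    prefix = downClosed⇒prefix k P closed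
    above-k : above k ≡ s
    above-k = sym (∑-reverse k (λ x′ → ⟦ B x′ ≤ᵇ B k + m ⟧))
    E : ℕ → ℕ
    E x = ⟦ belowRev k x ≡ᵇ l ⟧
    tail : ℕ
    tail = ∑[ z < k ∸ s ] E (s + z)
    belowRev-id : ∀ x → x < s → belowRev k x ≡ x
    belowRev-id x x<s = belowRev-full k x (λ x′ x′<x → ≤-trans
      (≤ᵇ-sound (trans (prefix x (<-≤-trans x<s s≤k)) (<ᵇ-true x<s)))
      (+-monoˡ-≤ m (anti (k ∸ suc x′) k (m∸n≤m k (suc x′)) ≤-refl)))
    shifted : ∑[ x < k ] ⟦ belowRev (suc k) (suc x) ≡ᵇ l ⟧ ≡ ∑[ x < s ] ⟦ suc x ≡ᵇ l ⟧ + tail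
    shifted = trans (∑-split≤ _ s≤k) (cong₂ _+_
      (∑-cong s (λ x x<s → cong (λ v → ⟦ v ≡ᵇ l ⟧) (trans (belowRev-suc k x) (cong₂ (λ b v → ⟦ b ⟧ + v)
         (trans (prefix x (<-≤-trans x<s s≤k)) (<ᵇ-true x<s)) (belowRev-id x x<s)))))
      (∑-cong (k ∸ s) (λ z z<k∸s → cong (λ v → ⟦ v ≡ᵇ l ⟧) (trans (belowRev-suc k (s + z))
         (cong (λ b → ⟦ b ⟧ + belowRev k (s + z))
           (trans (prefix (s + z) (subst (s + z <_) (m+[n∸m]≡n s≤k) (+-monoʳ-< s z<k∸s)))
                  (<ᵇ-false (m≤m+n s z))))))))

  small : ℕ → ℕ
  small k = ∑[ x < k ] ⟦ B x ≤ᵇ m ⟧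

  small+large : ∀ k → small k + ∑[ x < k ] ⟦ m <ᵇ B x ⟧ ≡ k
  small+large k = begin
    small k + ∑[ x < k ] ⟦ m <ᵇ B x ⟧     ≡⟨ sym (∑-distrib-+ k _ _) ⟩
    ∑[ x < k ] (⟦ B x ≤ᵇ m ⟧ + ⟦ m <ᵇ B x ⟧) ≡⟨ ∑-cong k (λ x _ → trans (+-comm ⟦ B x ≤ᵇ m ⟧ _) (⟦<ᵇ⟧+⟦≤ᵇ⟧ m (B x))) ⟩
    ∑[ _ < k ] 1                           ≡⟨ ∑-1 k ⟩
    k                                      ∎

  ∑-belowRev-split : ∀ k → Antitone k B → ∀ l →
    ∑[ x < k ] ⟦ belowRev k x ≡ᵇ l ⟧ ≡
      ∑[ x < k ] (⟦ m <ᵇ B (k ∸ suc x) ⟧ * ⟦ belowRev k x ≡ᵇ l ⟧) + ∑[ x < small k ] ⟦ x ≡ᵇ l ⟧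
  ∑-belowRev-split k anti l = begin
    ∑[ x < k ] E x
      ≡⟨ ∑-cong k (λ x _ → trans (sym (*-identityˡ (E x))) (cong (_* E x) (sym (⟦<ᵇ⟧+⟦≤ᵇ⟧ m (B (k ∸ suc x)))))) ⟩
    ∑[ x < k ] ((⟦ m <ᵇ B (k ∸ suc x) ⟧ + ⟦ smallRev x ⟧) * E x)
      ≡⟨ trans (∑-cong k (λ x _ → *-distribʳ-+ (E x) ⟦ m <ᵇ B (k ∸ suc x) ⟧ ⟦ smallRev x ⟧)) (∑-distrib-+ k _ _) ⟩
    Dsum + ∑[ x < k ] (⟦ smallRev x ⟧ * E x)
      ≡⟨ cong (Dsum +_) (trans (∑-downClosed k smallRev E smallRev-closed) (cong (λ r → ∑ r E) smallRev-count)) ⟩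
    Dsum + ∑[ x < small k ] E x
      ≡⟨ cong (Dsum +_) (∑-cong (small k) (λ x x<q → cong (λ v → ⟦ v ≡ᵇ l ⟧) (belowRev-id x x<q))) ⟩
    Dsum + ∑[ x < small k ] ⟦ x ≡ᵇ l ⟧ ∎
    where
    E : ℕ → ℕ
    E x = ⟦ belowRev k x ≡ᵇ l ⟧
    Dsum : ℕ
    Dsum = ∑[ x < k ] (⟦ m <ᵇ B (k ∸ suc x) ⟧ * E x)
    smallRev : ℕ → Bool
    smallRev x = B (k ∸ suc x) ≤ᵇ m
    smallRev-closed : DownClosed k smallRev
    smallRev-closed x y x≤y y<k sy = ≤ᵇ-true (≤-trans (antitone-reverse anti x y x≤y y<k) (≤ᵇ-sound sy))
    smallRev-count : ∑[ x < k ] ⟦ smallRev x ⟧ ≡ small k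
    smallRev-count = ∑-reverse k (λ x → ⟦ B x ≤ᵇ m ⟧)
    belowRev-id : ∀ x → x < small k → belowRev k x ≡ x
    belowRev-id x x<q = belowRev-full k x (λ x′ x′<x → ≤-trans
      (≤ᵇ-sound (trans (downClosed⇒prefix k smallRev smallRev-closed x (<-≤-trans x<q (∑⟦⟧≤ k _)))
                       (trans (cong (x <ᵇ_) smallRev-count) (<ᵇ-true x<q))))
      (m≤n+m m _))

  windows-identity : ∀ k → Antitone k B → ∀ l →
    ∑[ x < k ] ⟦ above x ≡ᵇ l ⟧ + ∑[ x < k ] (⟦ m <ᵇ B x ⟧ * ⟦ small k + x ≡ᵇ l ⟧)
    ≡ ∑[ x < k ] ⟦ x ≡ᵇ l ⟧ + ∑[ x < k ] (⟦ m <ᵇ B (k ∸ suc x) ⟧ * ⟦ belowRev k x ≡ᵇ l ⟧)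
  windows-identity k anti l = begin
    ∑[ x < k ] ⟦ above x ≡ᵇ l ⟧ + ∑[ x < k ] (⟦ large x ⟧ * ⟦ q + x ≡ᵇ l ⟧)
      ≡⟨ cong₂ _+_ (trans (above-↭-belowRev k anti l) (∑-belowRev-split k anti l))
                   (∑-downClosed k large _ large-closed) ⟩
    (Dsum + ∑[ x < q ] ⟦ x ≡ᵇ l ⟧) + ∑[ x < p ] ⟦ q + x ≡ᵇ l ⟧
      ≡⟨ trans (+-assoc Dsum _ _) (+-comm Dsum _) ⟩
    (∑[ x < q ] ⟦ x ≡ᵇ l ⟧ + ∑[ x < p ] ⟦ q + x ≡ᵇ l ⟧) + Dsum
      ≡⟨ cong (_+ Dsum) (sym (trans (cong (λ r → ∑[ x < r ] ⟦ x ≡ᵇ l ⟧) (sym (small+large k))) (∑-split q p _))) ⟩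
    ∑[ x < k ] ⟦ x ≡ᵇ l ⟧ + Dsum ∎
    where
    q : ℕ
    q = small k
    large : ℕ → Bool
    large x = m <ᵇ B x
    p : ℕ
    p = ∑[ x < k ] ⟦ large x ⟧
    large-closed : DownClosed k large
    large-closed x y x≤y y<k my = <ᵇ-true (<-≤-trans (<ᵇ-sound my) (anti x y x≤y y<k))
    Dsum : ℕ
    Dsum = ∑[ x < k ] (⟦ m <ᵇ B (k ∸ suc x) ⟧ * ⟦ belowRev k x ≡ᵇ l ⟧)

-- The diagrams of the theorem

≤ᵇ-+-swap : ∀ b b′ d d′ m → b + d ≡ b′ + d′ → (d ≤ᵇ d′ + m) ≡ (b′ ≤ᵇ b + m)
≤ᵇ-+-swap b b′ d d′ m b+d≡b′+d′ = begin
  (d ≤ᵇ d′ + m)               ≡⟨ sym (+-cancelˡ-≤ᵇ b d (d′ + m)) ⟩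
  (b + d ≤ᵇ b + (d′ + m))     ≡⟨ cong₂ _≤ᵇ_ (trans b+d≡b′+d′ (+-comm b′ d′)) (x∙yz≈y∙xz b d′ m) ⟩
  (d′ + b′ ≤ᵇ d′ + (b + m))   ≡⟨ +-cancelˡ-≤ᵇ d′ b′ (b + m) ⟩
  (b′ ≤ᵇ b + m)               ∎
  where open ≡-Reasoning

∸-<ᵇ : ∀ P Q m → m < P → (P ∸ suc m <ᵇ Q) ≡ (P ≤ᵇ Q + m)
∸-<ᵇ P Q m m<P with m≤n⇒∃[o]m+o≡n m<P
... | v , refl = begin
  (suc m + v ∸ suc m <ᵇ Q)      ≡⟨ cong (_<ᵇ Q) (m+n∸m≡n (suc m) v) ⟩
  (v <ᵇ Q)                      ≡⟨ sym (+-cancelˡ-<ᵇ (suc m) v Q) ⟩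
  (suc m + v <ᵇ suc m + Q)      ≡⟨ cong (suc m + v <ᵇ_) (trans (+-comm (suc m) Q) (+-suc Q m)) ⟩
  (suc m + v <ᵇ suc (Q + m))    ≡⟨ <ᵇ-suc (suc m + v) (Q + m) ⟩
  (suc m + v ≤ᵇ Q + m)          ∎
  where open ≡-Reasoning

T-cell∈T-row : ∀ d d′ n m → d′ ≤ d → m < n → inRange (d′ + 1) n (d + 1 + (n ∸ suc m)) ≡ (d ≤ᵇ d′ + m)
T-cell∈T-row d d′ n m d′≤d m<n with m≤n⇒∃[o]m+o≡n d′≤d | m≤n⇒∃[o]m+o≡n m<n
... | w , refl | r , refl rewrite m+n∸m≡n (suc m) r = begin
  (d′ + 1 ≤ᵇ d′ + w + 1 + r) ∧ (d′ + w + 1 + r <ᵇ d′ + 1 + (suc m + r))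
    ≡⟨ cong₂ _∧_ (≤ᵇ-true (≤-trans (m≤m+n (d′ + 1) (w + r)) (≤-reflexive (start d′ w r))))
                 (cong₂ _<ᵇ_ (end d′ w r) (end′ d′ m r)) ⟩
  (d′ + 1 + r + w <ᵇ d′ + 1 + r + suc m)
    ≡⟨ trans (+-cancelˡ-<ᵇ (d′ + 1 + r) w (suc m)) (<ᵇ-suc w m) ⟩
  (w ≤ᵇ m)
    ≡⟨ sym (+-cancelˡ-≤ᵇ d′ w m) ⟩
  (d′ + w ≤ᵇ d′ + m) ∎
  where
  open ≡-Reasoning
  start : ∀ d′ w r → d′ + 1 + (w + r) ≡ d′ + w + 1 + r
  start = solve-∀
  end : ∀ d′ w r → d′ + w + 1 + r ≡ d′ + 1 + r + w
  end = solve-∀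
  end′ : ∀ d′ m r → d′ + 1 + (suc m + r) ≡ d′ + 1 + r + suc m
  end′ = solve-∀

V-cell∈T-row : ∀ n b b′ d d′ m → m < b → b + d ≡ b′ + d′ → b′ + d′ ≤ n →
  inRange (d′ + 1) n (n + d + 1 + (b ∸ suc m)) ≡ (b′ ≤ᵇ m)
V-cell∈T-row n b b′ d d′ m m<b b+d≡b′+d′ b′+d′≤n with m≤n⇒∃[o]m+o≡n m<b
... | v , refl rewrite m+n∸m≡n (suc m) v = begin
  (d′ + 1 ≤ᵇ n + d + 1 + v) ∧ (n + d + 1 + v <ᵇ d′ + 1 + n)
    ≡⟨ cong₂ _∧_ (≤ᵇ-true (≤-trans (+-monoˡ-≤ 1 d′≤n+d+v) (≤-reflexive (regroup n d v))))
                 (cong₂ _<ᵇ_ (regroup′ n d v) (regroup″ d′ n)) ⟩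
  (n + 1 + (d + v) <ᵇ n + 1 + d′)
    ≡⟨ +-cancelˡ-<ᵇ (n + 1) (d + v) d′ ⟩
  (d + v <ᵇ d′)
    ≡⟨ sym (+-cancelˡ-<ᵇ (suc m) (d + v) d′) ⟩
  (suc m + (d + v) <ᵇ suc m + d′)
    ≡⟨ cong₂ _<ᵇ_ (trans (swap m d v) b+d≡b′+d′) (+-comm (suc m) d′) ⟩
  (b′ + d′ <ᵇ d′ + suc m)
    ≡⟨ trans (cong (_<ᵇ d′ + suc m) (+-comm b′ d′)) (+-cancelˡ-<ᵇ d′ b′ (suc m)) ⟩
  (b′ <ᵇ suc m)
    ≡⟨ <ᵇ-suc b′ m ⟩
  (b′ ≤ᵇ m) ∎
  where
  open ≡-Reasoning
  d′≤n+d+v : d′ ≤ n + d + v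
  d′≤n+d+v = ≤-trans (m≤n+m d′ b′) (≤-trans b′+d′≤n (≤-trans (m≤m+n n d) (m≤m+n (n + d) v)))
  regroup : ∀ n d v → n + d + v + 1 ≡ n + d + 1 + v
  regroup = solve-∀
  regroup′ : ∀ n d v → n + d + 1 + v ≡ n + 1 + (d + v)
  regroup′ = solve-∀
  regroup″ : ∀ d′ n → d′ + 1 + n ≡ n + 1 + d′
  regroup″ = solve-∀
  swap : ∀ m d v → suc m + (d + v) ≡ suc m + v + d
  swap = solve-∀

V-cell∈V-row : ∀ n b b′ d d′ m → m < b → b ≤ b′ → b + d ≡ b′ + d′ →
  inRange (n + d′ + 1) b′ (n + d + 1 + (b ∸ suc m)) ≡ true
V-cell∈V-row n b b′ d d′ m m<b b≤b′ b+d≡b′+d′ =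
  cong₂ _∧_ (≤ᵇ-true (≤-trans (+-monoˡ-≤ 1 (+-monoʳ-≤ n d′≤d)) (m≤m+n (n + d + 1) (b ∸ suc m))))
            (<ᵇ-true (begin-strict
               n + d + 1 + (b ∸ suc m)   <⟨ +-monoʳ-< (n + d + 1) (∸-monoʳ-< z<s m<b) ⟩
               n + d + 1 + b             ≡⟨ regroup n d b ⟩
               n + 1 + (b + d)           ≡⟨ cong (n + 1 +_) b+d≡b′+d′ ⟩
               n + 1 + (b′ + d′)         ≡⟨ regroup′ n b′ d′ ⟩
               n + d′ + 1 + b′           ∎))
  where
  open ≤-Reasoning
  d′≤d : d′ ≤ d
  d′≤d = +-cancelˡ-≤ b d′ d (≤-trans (+-monoˡ-≤ d′ b≤b′) (≤-reflexive (sym b+d≡b′+d′)))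
  regroup : ∀ n d b → n + d + 1 + b ≡ n + 1 + (b + d)
  regroup = solve-∀
  regroup′ : ∀ n b′ d′ → n + 1 + (b′ + d′) ≡ n + d′ + 1 + b′
  regroup′ = solve-∀

module Shapes (n k : ℕ) (α : Vec ℕ k) (adm : Admissible n k α) where
  open ≡-Reasoning

  A : ℕ → ℕ
  A = at α

  -- Rows are counted from 0 below: B x = α_{x+1}.
  B : ℕ → ℕ
  B x = A (suc x)

  open Windows B

  anti : Antitone k B
  anti = antitone-steps (λ y 1+y<k → proj₂ adm (suc y) (s≤s z≤n) 1+y<k)

  B≤α₁ : ∀ {x} → x < k → B x ≤ A 1
  B≤α₁ x<k = anti 0 _ z≤n x<k

  B≤n : ∀ {x} → x < k → B x ≤ n
  B≤n x<k = ≤-trans (B≤α₁ x<k) (proj₁ adm)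

  δ : ℕ → ℕ
  δ x = A 1 ∸ B x

  B+δ : ∀ {x} → x < k → B x + δ x ≡ A 1
  B+δ x<k = m+[n∸m]≡n (B≤α₁ x<k)

  cT cV : ℕ → ℕ
  cT x = δ x + 1
  cV x = n + δ x + 1

  Rows-R : Rows 1 k (λ _ → 1) (λ _ → n) (Rset n k)
  Rows-R = Rows-concatMap-interval 1 k (λ _ → 1) (λ _ → n)

  Rows-D : Rows 1 k (λ _ → 1) (λ x → B (k ∸ suc x)) (Dset k α)
  Rows-D = Rows-cong (Rows-concatMap-interval 1 k (λ _ → 1) (λ i → A (k ∸ i + 1))) refl refl
    (λ _ _ → refl) (λ x _ → cong A (+-comm (k ∸ suc x) 1))

  Rows-T : Rows 1 k cT (λ _ → n) (Tset n k α)
  Rows-T = Rows-cong (Rows-concatMap-interval 1 k (λ i → A 1 ∸ A i + 1) (λ i → n + A 1 ∸ A i)) refl refl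
    (λ _ _ → refl) length
    where
    length : ∀ x → x < k → suc (n + A 1 ∸ B x) ∸ (δ x + 1) ≡ n
    length x x<k = begin
      suc (n + A 1 ∸ B x) ∸ (δ x + 1)   ≡⟨ cong₂ (λ u v → suc u ∸ v) (+-∸-assoc n (B≤α₁ x<k)) (+-comm (δ x) 1) ⟩
      suc (n + δ x) ∸ suc (δ x)          ≡⟨ m+n∸n≡m n (δ x) ⟩
      n                                  ∎

  Rows-V : Rows (1 + k) k cV B (Vset n k α)
  Rows-V = Rows-cong (Rows-concatMap-interval (k + 1) (k + k) (λ i → n + A 1 ∸ A (i ∸ k) + 1) (λ _ → n + A 1))
    (+-comm k 1) rows≡k start length
    where
    rows≡k : suc (k + k) ∸ (k + 1) ≡ k
    rows≡k = trans (cong (suc (k + k) ∸_) (+-comm k 1)) (m+n∸m≡n k k)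
    row : ∀ x → k + 1 + x ∸ k ≡ suc x
    row x = trans (cong (_∸ k) (+-assoc k 1 x)) (m+n∸m≡n k (1 + x))
    start : ∀ x → x < suc (k + k) ∸ (k + 1) → n + A 1 ∸ A (k + 1 + x ∸ k) + 1 ≡ cV x
    start x x<k = cong (_+ 1) (trans (cong (λ i → n + A 1 ∸ A i) (row x))
                                     (+-∸-assoc n (B≤α₁ (subst (x <_) rows≡k x<k))))
    length : ∀ x → x < suc (k + k) ∸ (k + 1) → suc (n + A 1) ∸ (n + A 1 ∸ A (k + 1 + x ∸ k) + 1) ≡ B x
    length x x<k = begin
      suc (n + A 1) ∸ (n + A 1 ∸ A (k + 1 + x ∸ k) + 1)  ≡⟨ cong (λ i → suc (n + A 1) ∸ (n + A 1 ∸ A i + 1)) (row x) ⟩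
      suc (n + A 1) ∸ (n + A 1 ∸ B x + 1)                ≡⟨ cong (suc (n + A 1) ∸_) (+-comm (n + A 1 ∸ B x) 1) ⟩
      n + A 1 ∸ (n + A 1 ∸ B x)                          ≡⟨ m∸[m∸n]≡n (≤-trans (B≤α₁ (subst (x <_) rows≡k x<k)) (m≤n+m (A 1) n)) ⟩
      B x                                                ∎

  rowsBelow-T : ∀ m x → x < k → m < n → rowsBelow cT (λ _ → n) x (cT x + (n ∸ suc m)) ≡ above m x
  rowsBelow-T m x x<k m<n = ∑-cong x (λ x′ x′<x → cong ⟦_⟧ (trans
    (T-cell∈T-row (δ x) (δ x′) n m (∸-monoʳ-≤ (A 1) (anti x′ x (<⇒≤ x′<x) x<k)) m<n)
    (≤ᵇ-+-swap (B x) (B x′) (δ x) (δ x′) m (trans (B+δ x<k) (sym (B+δ (<-trans x′<x x<k)))))))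

  rowsBelow-V : ∀ m x → x < k → m < B x →
    rowsBelow cT (λ _ → n) k (cV x + (B x ∸ suc m)) + rowsBelow cV B x (cV x + (B x ∸ suc m)) ≡ small m k + x
  rowsBelow-V m x x<k m<Bx = cong₂ _+_
    (∑-cong k (λ x′ x′<k → cong ⟦_⟧ (V-cell∈T-row n (B x) (B x′) (δ x) (δ x′) m m<Bx
       (trans (B+δ x<k) (sym (B+δ x′<k))) (≤-trans (≤-reflexive (B+δ x′<k)) (proj₁ adm)))))
    (trans (∑-cong x (λ x′ x′<x → cong ⟦_⟧ (V-cell∈V-row n (B x) (B x′) (δ x) (δ x′) m m<Bx
       (anti x′ x (<⇒≤ x′<x) x<k) (trans (B+δ x<k) (sym (B+δ (<-trans x′<x x<k)))))))
     (∑-1 x))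

  rowsBelow-R : ∀ m x → m < n → rowsBelow (λ _ → 1) (λ _ → n) x (1 + (n ∸ suc m)) ≡ x
  rowsBelow-R m x m<n = trans (∑-cong x (λ _ _ → cong ⟦_⟧ (<ᵇ-true (∸-monoʳ-< z<s m<n)))) (∑-1 x)

  rowsBelow-D : ∀ m x → m < B (k ∸ suc x) →
    rowsBelow (λ _ → 1) (λ x → B (k ∸ suc x)) x (1 + (B (k ∸ suc x) ∸ suc m)) ≡ belowRev m k x
  rowsBelow-D m x m<B = ∑-cong x (λ x′ _ → cong ⟦_⟧ (∸-<ᵇ (B (k ∸ suc x)) (B (k ∸ suc x′)) m m<B))

  occ-SQ : ∀ m l → occ (m , l) (AL (SQset n k α)) ≡
    ∑[ x < k ] (⟦ m <ᵇ n ⟧ * ⟦ above m x ≡ᵇ l ⟧) + ∑[ x < k ] (⟦ m <ᵇ B x ⟧ * ⟦ small m k + x ≡ᵇ l ⟧)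
  occ-SQ m l = trans (occ-AL-Rows-++ Rows-T Rows-V m l) (cong₂ _+_
    (∑-cong k (λ x x<k → ⟦⟧-guard (m <ᵇ n) (λ m<n →
       cong (λ v → ⟦ v ≡ᵇ l ⟧) (rowsBelow-T m x x<k (<ᵇ-sound m<n)))))
    (∑-cong k (λ x x<k → ⟦⟧-guard (m <ᵇ B x) (λ m<Bx →
       cong (λ v → ⟦ v ≡ᵇ l ⟧) (rowsBelow-V m x x<k (<ᵇ-sound m<Bx))))))

  occ-R : ∀ m l → occ (m , l) (AL (Rset n k)) ≡ ∑[ x < k ] (⟦ m <ᵇ n ⟧ * ⟦ x ≡ᵇ l ⟧)
  occ-R m l = trans (occ-AL-Rows Rows-R m l) (∑-cong k (λ x _ → ⟦⟧-guard (m <ᵇ n) (λ m<n →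
    cong (λ v → ⟦ v ≡ᵇ l ⟧) (rowsBelow-R m x (<ᵇ-sound m<n)))))

  occ-D : ∀ m l → occ (m , l) (AL (Dset k α)) ≡ ∑[ x < k ] (⟦ m <ᵇ B (k ∸ suc x) ⟧ * ⟦ belowRev m k x ≡ᵇ l ⟧)
  occ-D m l = trans (occ-AL-Rows Rows-D m l) (∑-cong k (λ x _ → ⟦⟧-guard (m <ᵇ B (k ∸ suc x)) (λ m<B →
    cong (λ v → ⟦ v ≡ᵇ l ⟧) (rowsBelow-D m x (<ᵇ-sound m<B)))))

  occ-AL-SQ : ∀ m l → occ (m , l) (AL (SQset n k α)) ≡ occ (m , l) (AL (Rset n k) ++ AL (Dset k α))
  occ-AL-SQ m l with m <? n
  ... | yes m<n = begin
    occ (m , l) (AL (SQset n k α))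
      ≡⟨ trans (occ-SQ m l) (cong (_+ ∑[ x < k ] (⟦ m <ᵇ B x ⟧ * ⟦ small m k + x ≡ᵇ l ⟧)) (∑-guard-true k _ (<ᵇ-true m<n))) ⟩
    ∑[ x < k ] ⟦ above m x ≡ᵇ l ⟧ + ∑[ x < k ] (⟦ m <ᵇ B x ⟧ * ⟦ small m k + x ≡ᵇ l ⟧)
      ≡⟨ windows-identity m k anti l ⟩
    ∑[ x < k ] ⟦ x ≡ᵇ l ⟧ + ∑[ x < k ] (⟦ m <ᵇ B (k ∸ suc x) ⟧ * ⟦ belowRev m k x ≡ᵇ l ⟧)
      ≡⟨ sym (cong₂ _+_ (trans (occ-R m l) (∑-guard-true k _ (<ᵇ-true m<n))) (occ-D m l)) ⟩
    occ (m , l) (AL (Rset n k)) + occ (m , l) (AL (Dset k α))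
      ≡⟨ sym (∑ˡ-++ _ (AL (Rset n k)) (AL (Dset k α))) ⟩
    occ (m , l) (AL (Rset n k) ++ AL (Dset k α)) ∎
  ... | no m≮n = begin
    occ (m , l) (AL (SQset n k α))
      ≡⟨ trans (occ-SQ m l) (cong₂ _+_ (∑-guard-false k _ _ (λ _ _ → <ᵇ-false n≤m))
                                       (∑-guard-false k _ _ (λ x x<k → <ᵇ-false (≤-trans (B≤n x<k) n≤m)))) ⟩
    0
      ≡⟨ sym (cong₂ _+_ (trans (occ-R m l) (∑-guard-false k _ _ (λ _ _ → <ᵇ-false n≤m)))
                        (trans (occ-D m l) (∑-guard-false k _ _ (λ x x<k →
                                              <ᵇ-false (≤-trans (B≤n (∸-monoʳ-< z<s x<k)) n≤m))))) ⟩
    occ (m , l) (AL (Rset n k)) + occ (m , l) (AL (Dset k α))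
      ≡⟨ sym (∑ˡ-++ _ (AL (Rset n k)) (AL (Dset k α))) ⟩
    occ (m , l) (AL (Rset n k) ++ AL (Dset k α)) ∎
    where
    n≤m : n ≤ m
    n≤m = ≮⇒≥ m≮n

theorem1p2 : (n k : ℕ) → 1 ≤ n → 1 ≤ k → (α : Vec ℕ k) → Admissible n k α →
    AL (SQset n k α) ↭ (AL (Rset n k) ++ AL (Dset k α))
theorem1p2 n k _ _ α adm = occ⇒↭ _ _ (λ (m , l) → Shapes.occ-AL-SQ n k α adm m l)
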